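{- For integers $n\ge 0$ and $k\ge0$ let $J_{k,n}$ denote the number of maximal configurations of the Riviera model of length $n$ with exactly $k$ occupied lots (with the convention $J_{0,0}=1$, counting the empty configuration). Then, as formal power series, $$\sum_{n\ge0}\sum_{k\ge0}J_{k,n}x^ky^n=\frac{1+xy-(x-x^2)y^2+x^2y^3-x^3y^5}{1-xy^2-x^2y^3-x^2y^4+x^3y^6}.$$
   Context: Riviera model: a configuration of length $n$ is a word $C=(c_1,\dots,c_n)\in\{0,1\}^n$ ($c_i=1$: lot $i$ occupied; $c_i=0$: empty), with $c_j=0$ for $j\le 0$ and $j\ge n+1$. $C$ is permissible if there is no $i\in\{1,\dots,n\}$ with $c_{i-1}=c_i=c_{i+1}=1$. $C$ is maximal if it is permissible and for every $i$ with $c_i=0$, changing $c_i$ to $1$ yields a non-permissible configuration. The number of occupied lots is $\sum_i c_i$. -}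

module Defs where

open import Data.Bool using (Bool; true; false)
import Data.Bool.Properties as BoolP
open import Data.Nat using (ℕ; zero; suc; _+_; _∸_)
import Data.Nat as ℕ
open import Data.Integer using (ℤ; +_; -_) renaming (_+_ to _+ℤ_; _*_ to _*ℤ_)
open import Data.Fin using (Fin; toℕ)
open import Data.Fin.Properties using (all?)
open import Data.Vec using (Vec; []; _∷_; _[_]≔_)
open import Data.List using (List; []; _∷_; _++_; map; length; filter; foldr; upTo)
open import Data.Product using (_×_)
open import Relation.Binary.PropositionalEquality using (_≡_)
open import Relation.Nullary using (¬_; Dec)
open import Relation.Nullary.Decidable using (_×-dec_; ¬?; _→-dec_)

-- Configuration of length n: c = (c_1,…,c_n), true = occupied.
Config : ℕ → Set
Config n = Vec Bool n

get₀ : ∀ {n} → Config n → ℕ → Bool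
get₀ []      _       = false
get₀ (b ∷ c) zero    = b
get₀ (b ∷ c) (suc j) = get₀ c j

-- c_j for j ∈ ℕ (1-based), with c_0 = 0 and c_j = 0 for j ≥ n+1
lot : ∀ {n} → Config n → ℕ → Bool
lot c zero    = false
lot c (suc j) = get₀ c j

-- For i : Fin n, the lot index is suc (toℕ i) ∈ {1,…,n}.
Permissible : ∀ {n} → Config n → Set
Permissible {n} c = ∀ (i : Fin n) →
  ¬ (lot c (toℕ i) ≡ true × lot c (suc (toℕ i)) ≡ true × lot c (suc (suc (toℕ i))) ≡ true)

Maximal : ∀ {n} → Config n → Set
Maximal {n} c = Permissible c ×
  (∀ (i : Fin n) → lot c (suc (toℕ i)) ≡ false → ¬ Permissible (c [ i ]≔ true))

permissible? : ∀ {n} (c : Config n) → Dec (Permissible c)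
permissible? c = all? λ i →
  ¬? ((lot c (toℕ i) BoolP.≟ true) ×-dec ((lot c (suc (toℕ i)) BoolP.≟ true)
       ×-dec (lot c (suc (suc (toℕ i))) BoolP.≟ true)))

maximal? : ∀ {n} (c : Config n) → Dec (Maximal c)
maximal? c = permissible? c ×-dec all? λ i →
  (lot c (suc (toℕ i)) BoolP.≟ false) →-dec ¬? (permissible? (c [ i ]≔ true))

occupied : ∀ {n} → Config n → ℕ
occupied []          = 0
occupied (true ∷ c)  = suc (occupied c)
occupied (false ∷ c) = occupied c

allConfigs : (n : ℕ) → List (Config n)
allConfigs zero    = [] ∷ []
allConfigs (suc n) = map (false ∷_) (allConfigs n) ++ map (true ∷_) (allConfigs n)

J : ℕ → ℕ → ℕ
J k n = length (filter (λ c → maximal? c ×-dec (occupied c ℕ.≟ k)) (allConfigs n))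

-- Formal power series in x, y with integer coefficients:
-- S k n = coefficient of x^k y^n.
Series : Set
Series = ℕ → ℕ → ℤ

sumℤ : List ℤ → ℤ
sumℤ = foldr _+ℤ_ (+ 0)

_⊛_ : Series → Series → Series
(f ⊛ g) k n = sumℤ (map (λ i → sumℤ (map (λ j → f i j *ℤ g (k ∸ i) (n ∸ j)) (upTo (suc n)))) (upTo (suc k)))

JSeries : Series
JSeries k n = + J k n

Num : Series
Num 0 0 = + 1
Num 1 1 = + 1
Num 1 2 = - (+ 1)
Num 2 2 = + 1
Num 2 3 = + 1
Num 3 5 = - (+ 1)
Num _ _ = + 0

Den : Series
Den 0 0 = + 1
Den 1 2 = - (+ 1)
Den 2 3 = - (+ 1)
Den 2 4 = - (+ 1)
Den 3 6 = + 1
Den _ _ = + 0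

-- A configuration is maximal exactly when every lot passes a test on the window of two lots
-- on either side of it: the lot is not the middle of three occupied lots, and if it is empty,
-- occupying it would create three consecutive occupied lots. Scanning these windows from left
-- to right is done by a seven-state automaton, and counting the words it accepts by length (y)
-- and number of occupied lots (x) gives linear equations for generating functions: with U and V
-- the series of the states reached after …01 and …11,
--   J = 1 + x²y³ V + x y U,   U = 1 + x y² U + x y V,   V = 1 + y J.
-- Eliminating U and V gives Den · J = Num; everything is checked coefficient by coefficient,
-- multiplication by a monomial x^a y^b being a shift of coefficients.

module Submission where

open import Defs
open import Data.Bool using (Bool; true; false; not; _∧_; _∨_; if_then_else_)
open import Data.Bool.Properties
  using (∧-identityʳ; ∧-zeroʳ; ∧-conicalˡ; ∧-conicalʳ; not-injective; ¬-not)
import Data.Bool.Properties as Bool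
open import Data.Fin using (Fin; toℕ; fromℕ<)
import Data.Fin as Fin
open import Data.Fin.Properties using (toℕ-fromℕ<)
open import Data.Integer using (ℤ; +_; -_; _-_) renaming (_+_ to _+ℤ_; _*_ to _*ℤ_)
import Data.Integer.Properties as ℤ
open import Algebra.Properties.CommutativeSemigroup ℤ.+-commutativeSemigroup using (interchange)
open import Data.Integer.Tactic.RingSolver using (solve-∀)
open import Data.List using ([]; _∷_; _++_; map; filter; length; upTo; applyUpTo)
open import Data.List.Properties using (length-++; filter-++; filter-≐; filter-none; map-cong; map-upTo)
import Data.List.Relation.Unary.All as All
open import Data.Nat using (ℕ; zero; suc; pred; _+_; _∸_; _≤_; _<?_; _≡ᵇ_; _<ᵇ_; s≤s)
open import Data.Nat.Properties using (_≟_; suc-injective; +-suc; +-identityʳ; 1+n≢n; m≢1+n+m; ≮⇒≥)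
open import Data.Product using (_×_; _,_; map₁; map₂)
open import Data.Vec using ([]; _∷_; _[_]≔_)
open import Function using (_∘_)
open import Function.Bundles using (_⇔_; mk⇔; Equivalence)
open import Function.Construct.Composition using (_⇔-∘_)
open import Function.Construct.Symmetry using (⇔-sym)
open import Level using (0ℓ)
open import Relation.Binary.Bundles using (Setoid)
open import Relation.Binary.PropositionalEquality
  using (_≡_; _≢_; refl; sym; trans; cong; cong₂; subst; ≢-sym; module ≡-Reasoning)
import Relation.Binary.Reasoning.Setoid as SetoidReasoning
open import Relation.Nullary using (¬_; Dec; does; yes; no; contradiction)
open import Relation.Nullary.Decidable using (_×-dec_; dec-true; dec-false)

-- Maximality is local

-- The window a b x y z is centred at lot x.
locallyMaximal : Bool → Bool → Bool → Bool → Bool → Bool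
locallyMaximal a b x y z = not (b ∧ x ∧ y) ∧ (x ∨ (a ∧ b) ∨ (b ∧ y) ∨ (y ∧ z))

triple : (ℕ → Bool) → ℕ → Bool
triple P s = P s ∧ P (suc s) ∧ P (2 + s)

-- For a sequence of lots P, windowAt P t is centred at lot 2 + t, and blocked P t says that
-- occupying lot 2 + t would complete three consecutive occupied lots.
blocked : (ℕ → Bool) → ℕ → Bool
blocked P t = (P t ∧ P (suc t)) ∨ (P (suc t) ∧ P (3 + t)) ∨ (P (3 + t) ∧ P (4 + t))

windowAt : (ℕ → Bool) → ℕ → Bool
windowAt P t = locallyMaximal (P t) (P (suc t)) (P (2 + t)) (P (3 + t)) (P (4 + t))

true≢false : true ≢ false
true≢false ()

∧₃-true : ∀ x y z → x ∧ y ∧ z ≡ true → x ≡ true × y ≡ true × z ≡ true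
∧₃-true true true true refl = refl , refl , refl

∨₃-false : ∀ x y z → x ∨ y ∨ z ≡ false → x ≡ false × y ≡ false × z ≡ false
∨₃-false false false false refl = refl , refl , refl

NoTriple : (ℕ → Bool) → Set
NoTriple P = ∀ s → triple P s ≡ false

module Fill {P P′ : ℕ → Bool} {t : ℕ}
            (filled : P′ (2 + t) ≡ true) (unchanged : ∀ j → j ≢ 2 + t → P′ j ≡ P j) where

  triplesThrough : triple P′ t ∨ triple P′ (suc t) ∨ triple P′ (2 + t) ≡ blocked P t
  triplesThrough
    rewrite filled
          | unchanged t (m≢1+n+m t)
          | unchanged (suc t) (m≢1+n+m (suc t) {0})
          | unchanged (3 + t) 1+n≢n
          | unchanged (4 + t) (≢-sym (m≢1+n+m (2 + t) {1}))
          | ∧-identityʳ (P (suc t))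
          = refl

  notBlocked : NoTriple P′ → blocked P t ≡ false
  notBlocked none = begin
    blocked P t                                              ≡⟨ sym triplesThrough ⟩
    triple P′ t ∨ triple P′ (suc t) ∨ triple P′ (2 + t)      ≡⟨ cong₂ _∨_ (none t) (cong₂ _∨_ (none (suc t)) (none (2 + t))) ⟩
    false                                                    ∎
    where open ≡-Reasoning

  triplesThrough-free : blocked P t ≡ false →
    triple P′ t ≡ false × triple P′ (suc t) ≡ false × triple P′ (2 + t) ≡ false
  triplesThrough-free free = ∨₃-false _ _ _ (trans triplesThrough free)

  noTriple-fill : NoTriple P → blocked P t ≡ false → NoTriple P′
  noTriple-fill none free s with s ≟ t | s ≟ suc t | s ≟ 2 + t | triplesThrough-free free
  ... | yes refl | _        | _        | at-t , _ = at-t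
  ... | no _     | yes refl | _        | _ , at-1+t , _ = at-1+t
  ... | no _     | no _     | yes refl | _ , _ , at-2+t = at-2+t
  ... | no s≢t | no s≢1+t | no s≢2+t | _
    rewrite unchanged s s≢2+t
          | unchanged (suc s) (s≢1+t ∘ suc-injective)
          | unchanged (2 + s) (s≢t ∘ suc-injective ∘ suc-injective)
          = none s

-- pad c j is lot j - 1 of c, so that the window of every lot of c starts at a natural number.
pad : ∀ {n} → Config n → ℕ → Bool
pad c = get₀ (false ∷ false ∷ c)

lot-pad : ∀ {n} (c : Config n) j → lot c j ≡ pad c (suc j)
lot-pad c zero    = refl
lot-pad c (suc j) = refl

get₀-beyond : ∀ {n} (c : Config n) {j} → n ≤ j → get₀ c j ≡ false
get₀-beyond []      _         = refl
get₀-beyond (_ ∷ c) (s≤s n≤j) = get₀-beyond c n≤j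

get₀-≔-same : ∀ {n} (c : Config n) i v → get₀ (c [ i ]≔ v) (toℕ i) ≡ v
get₀-≔-same (_ ∷ c) Fin.zero    v = refl
get₀-≔-same (_ ∷ c) (Fin.suc i) v = get₀-≔-same c i v

get₀-≔-other : ∀ {n} (c : Config n) i v {j} → j ≢ toℕ i → get₀ (c [ i ]≔ v) j ≡ get₀ c j
get₀-≔-other (_ ∷ c) Fin.zero    v {zero}  j≢i = contradiction refl j≢i
get₀-≔-other (_ ∷ c) Fin.zero    v {suc j} j≢i = refl
get₀-≔-other (_ ∷ c) (Fin.suc i) v {zero}  j≢i = refl
get₀-≔-other (_ ∷ c) (Fin.suc i) v {suc j} j≢i = get₀-≔-other c i v (j≢i ∘ cong suc)

pad-≔-other : ∀ {n} (c : Config n) i v j → j ≢ 2 + toℕ i → pad (c [ i ]≔ v) j ≡ pad c j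
pad-≔-other c i v zero          _   = refl
pad-≔-other c i v (suc zero)    _   = refl
pad-≔-other c i v (suc (suc j)) j≢i = get₀-≔-other c i v (j≢i ∘ cong (suc ∘ suc))

module _ {n} (c : Config n) where

  full⇒triple : ∀ {s} → lot c s ≡ true × lot c (suc s) ≡ true × lot c (2 + s) ≡ true →
                triple (pad c) (suc s) ≡ true
  full⇒triple {s} (p , q , r) rewrite sym (lot-pad c s) | p | q | r = refl

  triple⇒full : ∀ {s} → triple (pad c) (suc s) ≡ true →
                lot c s ≡ true × lot c (suc s) ≡ true × lot c (2 + s) ≡ true
  triple⇒full {s} full with ∧₃-true (pad c (suc s)) _ _ full
  ... | p , q , r = trans (lot-pad c s) p , q , r

  permissible⇔ : Permissible c ⇔ (∀ (i : Fin n) → triple (pad c) (suc (toℕ i)) ≡ false)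
  permissible⇔ = mk⇔ (λ perm i → ¬-not (perm i ∘ triple⇒full))
                     (λ none i full → true≢false (trans (sym (full⇒triple full)) (none i)))

  permissible⇒noTriple : Permissible c → NoTriple (pad c)
  permissible⇒noTriple perm zero = refl
  permissible⇒noTriple perm (suc j) with j <? n
  ... | yes j<n = subst (λ m → triple (pad c) (suc m) ≡ false) (toℕ-fromℕ< j<n)
                        (Equivalence.to permissible⇔ perm (fromℕ< j<n))
  ... | no  j≮n rewrite get₀-beyond c (≮⇒≥ j≮n) = ∧-zeroʳ (pad c (suc j))

  noTriple⇒permissible : NoTriple (pad c) → Permissible c
  noTriple⇒permissible none = Equivalence.from permissible⇔ (λ i → none (suc (toℕ i)))

module _ {n} (c : Config n) where

  module FillAt (i : Fin n) = Fill {pad c} {pad (c [ i ]≔ true)} {toℕ i}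
                                   (get₀-≔-same c i true) (pad-≔-other c i true)

  occupied-or-blocked : Maximal c → ∀ i → pad c (2 + toℕ i) ∨ blocked (pad c) (toℕ i) ≡ true
  occupied-or-blocked (perm , maxi) i with pad c (2 + toℕ i) in occ | blocked (pad c) (toℕ i) in blk
  ... | true  | _     = refl
  ... | false | true  = refl
  ... | false | false = contradiction (noTriple⇒permissible (c [ i ]≔ true)
                          (FillAt.noTriple-fill i (permissible⇒noTriple c perm) blk)) (maxi i occ)

  maximal⇔windows : Maximal c ⇔ (∀ (i : Fin n) → windowAt (pad c) (toℕ i) ≡ true)
  maximal⇔windows = mk⇔ to from
    where
    to : Maximal c → ∀ i → windowAt (pad c) (toℕ i) ≡ true
    to max@(perm , _) i rewrite permissible⇒noTriple c perm (suc (toℕ i)) = occupied-or-blocked max i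

    from : (∀ i → windowAt (pad c) (toℕ i) ≡ true) → Maximal c
    from windows = perm , maxi
      where
      perm : Permissible c
      perm = Equivalence.from (permissible⇔ c) (λ i → not-injective (∧-conicalˡ _ _ (windows i)))

      maxi : ∀ i → lot c (suc (toℕ i)) ≡ false → ¬ Permissible (c [ i ]≔ true)
      maxi i empty perm′ = true≢false (begin
        true                                                ≡⟨ sym (∧-conicalʳ _ _ (windows i)) ⟩
        pad c (2 + toℕ i) ∨ blocked (pad c) (toℕ i)         ≡⟨ cong (_∨ blocked (pad c) (toℕ i)) empty ⟩
        blocked (pad c) (toℕ i)                             ≡⟨ FillAt.notBlocked i (permissible⇒noTriple _ perm′) ⟩
        false                                               ∎)
        where open ≡-Reasoning

allWindows : ∀ {n} → Bool → Bool → Config n → Bool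
allWindows a b []      = true
allWindows a b (x ∷ r) = windowAt (get₀ (a ∷ b ∷ x ∷ r)) 0 ∧ allWindows b x r

allWindows⇔ : ∀ {n} a b (c : Config n) →
  allWindows a b c ≡ true ⇔ (∀ (i : Fin n) → windowAt (get₀ (a ∷ b ∷ c)) (toℕ i) ≡ true)
allWindows⇔ a b c = mk⇔ (to a b c) (from a b c)
  where
  to : ∀ {n} a b (c : Config n) → allWindows a b c ≡ true →
       ∀ (i : Fin n) → windowAt (get₀ (a ∷ b ∷ c)) (toℕ i) ≡ true
  to a b (x ∷ r) all Fin.zero    = ∧-conicalˡ _ _ all
  to a b (x ∷ r) all (Fin.suc i) = to b x r (∧-conicalʳ _ _ all) i

  from : ∀ {n} a b (c : Config n) → (∀ (i : Fin n) → windowAt (get₀ (a ∷ b ∷ c)) (toℕ i) ≡ true) →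
         allWindows a b c ≡ true
  from a b []      _   = refl
  from a b (x ∷ r) all = cong₂ _∧_ (all Fin.zero) (from b x r (all ∘ Fin.suc))

-- An automaton recognising maximal configurations

-- States are named after the part of the word read so far that still matters. ready is the
-- start state and is also reached after …110; open0 and open01 are reached after reading 0,
-- resp. 01, from the start or after …1100, resp. …1001: their last empty lot is not yet blocked.
data State : Set where
  ready open0 open01 end01 end11 end010 dead : State

step : State → Bool → State
step ready  false = open0
step ready  true  = end01
step open0  false = dead
step open0  true  = open01
step open01 false = dead
step open01 true  = end11
step end01  false = end010
step end01  true  = end11
step end11  false = ready
step end11  true  = dead
step end010 false = dead
step end010 true  = end01
step dead   _     = dead

accepting : State → Bool
accepting ready = true
accepting end01 = true
accepting end11 = true
accepting _     = false

run : ∀ {n} → State → Config n → Bool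
run s []      = accepting s
run s (x ∷ c) = run (step s x) c

run-dead : ∀ {n} (c : Config n) → run dead c ≡ false
run-dead []      = refl
run-dead (_ ∷ c) = run-dead c

-- The state reached after a word ending in a b x y whose windows are legal up to the one
-- centred at b; the windows centred at x and y still wait for the next two letters.
windowState : Bool → Bool → Bool → Bool → State
windowState false false false false = dead
windowState false false false true  = open01
windowState false false true  false = end010
windowState false false true  true  = end11
windowState false true  false false = dead
windowState false true  false true  = end01
windowState false true  true  false = ready
windowState false true  true  true  = dead
windowState true  false false false = dead
windowState true  false false true  = open01
windowState true  false true  false = end010
windowState true  false true  true  = end11
windowState true  true  false false = open0
windowState true  true  false true  = end01
windowState true  true  true  false = ready
windowState true  true  true  true  = dead

step-windowState : ∀ a b x y z →
  step (windowState a b x y) z ≡ (if locallyMaximal a b x y z then windowState b x y z else dead)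
step-windowState false false false false false = refl
step-windowState false false false false true  = refl
step-windowState false false false true  false = refl
step-windowState false false false true  true  = refl
step-windowState false false true  false false = refl
step-windowState false false true  false true  = refl
step-windowState false false true  true  false = refl
step-windowState false false true  true  true  = refl
step-windowState false true  false false false = refl
step-windowState false true  false false true  = refl
step-windowState false true  false true  false = refl
step-windowState false true  false true  true  = refl
step-windowState false true  true  false false = refl
step-windowState false true  true  false true  = refl
step-windowState false true  true  true  false = refl
step-windowState false true  true  true  true  = refl
step-windowState true  false false false false = refl
step-windowState true  false false false true  = refl
step-windowState true  false false true  false = refl
step-windowState true  false false true  true  = refl
step-windowState true  false true  false false = refl
step-windowState true  false true  false true  = refl
step-windowState true  false true  true  false = refl
step-windowState true  false true  true  true  = refl
step-windowState true  true  false false false = refl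
step-windowState true  true  false false true  = refl
step-windowState true  true  false true  false = refl
step-windowState true  true  false true  true  = refl
step-windowState true  true  true  false false = refl
step-windowState true  true  true  false true  = refl
step-windowState true  true  true  true  false = refl
step-windowState true  true  true  true  true  = refl

accepting-windowState : ∀ a b x y → accepting (windowState a b x y) ≡ allWindows a b (x ∷ y ∷ [])
accepting-windowState false false false false = refl
accepting-windowState false false false true  = refl
accepting-windowState false false true  false = refl
accepting-windowState false false true  true  = refl
accepting-windowState false true  false false = refl
accepting-windowState false true  false true  = refl
accepting-windowState false true  true  false = refl
accepting-windowState false true  true  true  = refl
accepting-windowState true  false false false = refl
accepting-windowState true  false false true  = refl
accepting-windowState true  false true  false = refl
accepting-windowState true  false true  true  = refl
accepting-windowState true  true  false false = refl
accepting-windowState true  true  false true  = refl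
accepting-windowState true  true  true  false = refl
accepting-windowState true  true  true  true  = refl

run-windowState : ∀ {n} a b x y (r : Config n) → run (windowState a b x y) r ≡ allWindows a b (x ∷ y ∷ r)
run-windowState a b x y []      = accepting-windowState a b x y
run-windowState a b x y (z ∷ r) rewrite step-windowState a b x y z with locallyMaximal a b x y z
... | true  = run-windowState b x y z r
... | false = run-dead r

run-ready : ∀ {n} (c : Config n) → run ready c ≡ allWindows false false c
run-ready []                  = refl
run-ready (false ∷ [])        = refl
run-ready (true ∷ [])         = refl
run-ready (false ∷ false ∷ r) = run-windowState false false false false r
run-ready (false ∷ true ∷ r)  = run-windowState false false false true r
run-ready (true ∷ false ∷ r)  = run-windowState false false true false r
run-ready (true ∷ true ∷ r)   = run-windowState false false true true r

maximal⇔accepted : ∀ {n} (c : Config n) → Maximal c ⇔ run ready c ≡ true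
maximal⇔accepted c rewrite run-ready c = ⇔-sym (allWindows⇔ false false c) ⇔-∘ maximal⇔windows c

length-filter-map : ∀ {A B : Set} {P : B → Set} (P? : ∀ y → Dec (P y)) (f : A → B) xs →
  length (filter P? (map f xs)) ≡ length (filter (P? ∘ f) xs)
length-filter-map P? f []       = refl
length-filter-map P? f (x ∷ xs) with does (P? (f x))
... | true  = cong suc (length-filter-map P? f xs)
... | false = length-filter-map P? f xs

length-filter-[_] : ∀ {A : Set} {P : A → Set} x (P? : ∀ x → Dec (P x)) →
  length (filter P? (x ∷ [])) ≡ (if does (P? x) then 1 else 0)
length-filter-[ x ] P? with does (P? x)
... | true  = refl
... | false = refl

accepts? : ∀ s k {n} (c : Config n) → Dec (run s c ≡ true × occupied c ≡ k)
accepts? s k c = (run s c Bool.≟ true) ×-dec (occupied c ≟ k)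

count : State → ℕ → ℕ → ℕ
count s k n = length (filter (accepts? s k) (allConfigs n))

countPred : State → ℕ → ℕ → ℕ
countPred s zero    n = 0
countPred s (suc k) n = count s k n

count-suc : ∀ s k n → count s k (suc n) ≡ count (step s false) k n + countPred (step s true) k n
count-suc s k n = begin
  length (filter (accepts? s k) (map (false ∷_) cs ++ map (true ∷_) cs))
    ≡⟨ cong length (filter-++ (accepts? s k) (map (false ∷_) cs) _) ⟩
  length (filter (accepts? s k) (map (false ∷_) cs) ++ filter (accepts? s k) (map (true ∷_) cs))
    ≡⟨ length-++ (filter (accepts? s k) (map (false ∷_) cs)) ⟩
  length (filter (accepts? s k) (map (false ∷_) cs)) + length (filter (accepts? s k) (map (true ∷_) cs))
    ≡⟨ cong₂ _+_ (length-filter-map (accepts? s k) (false ∷_) cs) (length-filter-map (accepts? s k) (true ∷_) cs) ⟩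
  count (step s false) k n + length (filter ((accepts? s k) ∘ (true ∷_)) cs)
    ≡⟨ cong (_+_ (count (step s false) k n)) (leading-true k) ⟩
  count (step s false) k n + countPred (step s true) k n ∎
  where
  open ≡-Reasoning
  cs = allConfigs n
  leading-true : ∀ k → length (filter ((accepts? s k) ∘ (true ∷_)) cs)
                       ≡ countPred (step s true) k n
  leading-true zero    = cong length (filter-none _ (All.universal (λ _ ()) cs))
  leading-true (suc k) = cong length (filter-≐ _ _ (map₂ suc-injective , map₂ (cong suc)) cs)

J≡count : ∀ k n → J k n ≡ count ready k n
J≡count k n = cong length (filter-≐ _ _ (map₁ (Equivalence.to (maximal⇔accepted _)) ,
                                         map₁ (Equivalence.from (maximal⇔accepted _))) (allConfigs n))

-- Formal power series

infix  4 _≈_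
infixl 6 _⊕_ _⊖_
infix  8 ⊝_

-- A record rather than a function type, so that f and g can be inferred from f ≈ g.
record _≈_ (f g : Series) : Set where
  constructor coeffwise
  field coeff : ∀ k n → f k n ≡ g k n
open _≈_

≈-refl : ∀ {f} → f ≈ f
≈-refl = coeffwise λ _ _ → refl

≈-sym : ∀ {f g} → f ≈ g → g ≈ f
≈-sym f≈g = coeffwise λ k n → sym (coeff f≈g k n)

≈-trans : ∀ {f g h} → f ≈ g → g ≈ h → f ≈ h
≈-trans f≈g g≈h = coeffwise λ k n → trans (coeff f≈g k n) (coeff g≈h k n)

seriesSetoid : Setoid 0ℓ 0ℓ
seriesSetoid = record
  { Carrier       = Series
  ; _≈_           = _≈_
  ; isEquivalence = record
    { refl  = ≈-refl
    ; sym   = ≈-sym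
    ; trans = ≈-trans
    }
  }

_⊕_ : Series → Series → Series
(f ⊕ g) k n = f k n +ℤ g k n

⊝_ : Series → Series
(⊝ f) k n = - f k n

_⊖_ : Series → Series → Series
f ⊖ g = f ⊕ ⊝ g

⊕-cong : ∀ {f f′ g g′} → f ≈ f′ → g ≈ g′ → f ⊕ g ≈ f′ ⊕ g′
⊕-cong f≈f′ g≈g′ = coeffwise λ k n → cong₂ _+ℤ_ (coeff f≈f′ k n) (coeff g≈g′ k n)

⊕-congˡ : ∀ f {g g′} → g ≈ g′ → f ⊕ g ≈ f ⊕ g′
⊕-congˡ f g≈g′ = ⊕-cong (≈-refl {f}) g≈g′

⊖-cong : ∀ {f f′ g g′} → f ≈ f′ → g ≈ g′ → f ⊖ g ≈ f′ ⊖ g′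
⊖-cong f≈f′ g≈g′ = coeffwise λ k n → cong₂ _-_ (coeff f≈f′ k n) (coeff g≈g′ k n)

0ₛ : Series
0ₛ _ _ = + 0

-- does (k ≟ a) computes to k ≡ᵇ a, which is how the lemmas below evaluate monomials.
monomial : ℕ → ℕ → Series
monomial a b k n = if (k ≡ᵇ a) ∧ (n ≡ᵇ b) then + 1 else + 0

1ₛ : Series
1ₛ = monomial 0 0

monomial-diag : ∀ a b → monomial a b a b ≡ + 1
monomial-diag a b rewrite dec-true (a ≟ a) refl | dec-true (b ≟ b) refl = refl

monomial-offˣ : ∀ {a b i} j → i ≢ a → monomial a b i j ≡ + 0
monomial-offˣ {a} {i = i} j i≢a rewrite dec-false (i ≟ a) i≢a = refl

monomial-offʸ : ∀ {a b j} i → j ≢ b → monomial a b i j ≡ + 0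
monomial-offʸ {a} {b} {j} i j≢b with i ≡ᵇ a
... | true  rewrite dec-false (j ≟ b) j≢b = refl
... | false = refl

-- multiplication by x^a y^b
shift : ℕ → ℕ → Series → Series
shift (suc a) b       f zero    n       = + 0
shift (suc a) b       f (suc k) n       = shift a b f k n
shift zero    (suc b) f k       zero    = + 0
shift zero    (suc b) f k       (suc n) = shift zero b f k n
shift zero    zero    f k       n       = f k n

shift-cong : ∀ a b {f g} → f ≈ g → shift a b f ≈ shift a b g
shift-cong a b {f} {g} f≈g = coeffwise (go a b)
  where
  go : ∀ a b k n → shift a b f k n ≡ shift a b g k n
  go (suc a) b       zero    n       = refl
  go (suc a) b       (suc k) n       = go a b k n
  go zero    (suc b) k       zero    = refl
  go zero    (suc b) k       (suc n) = go zero b k n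
  go zero    zero    k       n       = coeff f≈g k n

shift-⊕ : ∀ a b f g → shift a b (f ⊕ g) ≈ shift a b f ⊕ shift a b g
shift-⊕ a b f g = coeffwise (go a b)
  where
  go : ∀ a b k n → shift a b (f ⊕ g) k n ≡ (shift a b f ⊕ shift a b g) k n
  go (suc a) b       zero    n       = refl
  go (suc a) b       (suc k) n       = go a b k n
  go zero    (suc b) k       zero    = refl
  go zero    (suc b) k       (suc n) = go zero b k n
  go zero    zero    k       n       = refl

shift-0ₛ : ∀ a b → shift a b 0ₛ ≈ 0ₛ
shift-0ₛ a b = coeffwise (go a b)
  where
  go : ∀ a b k n → shift a b 0ₛ k n ≡ + 0
  go (suc a) b       zero    n       = refl
  go (suc a) b       (suc k) n       = go a b k n
  go zero    (suc b) k       zero    = refl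
  go zero    (suc b) k       (suc n) = go zero b k n
  go zero    zero    k       n       = refl

shift-y-zero : ∀ a b f k → shift a (suc b) f k zero ≡ + 0
shift-y-zero zero    b f k       = refl
shift-y-zero (suc a) b f zero    = refl
shift-y-zero (suc a) b f (suc k) = shift-y-zero a b f k

shift-y-suc : ∀ a b f k n → shift a (suc b) f k (suc n) ≡ shift a b f k n
shift-y-suc zero    b f k       n = refl
shift-y-suc (suc a) b f zero    n = refl
shift-y-suc (suc a) b f (suc k) n = shift-y-suc a b f k n

shift-shift : ∀ a b c d f → shift a b (shift c d f) ≈ shift (c + a) (d + b) f
shift-shift a b c d f = coeffwise (go a b)
  where
  go : ∀ a b k n → shift a b (shift c d f) k n ≡ shift (c + a) (d + b) f k n
  go (suc a) b       zero    n       rewrite +-suc c a = refl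
  go (suc a) b       (suc k) n       rewrite +-suc c a = go a b k n
  go zero    (suc b) k       zero    rewrite +-suc d b = sym (shift-y-zero (c + 0) (d + b) f k)
  go zero    (suc b) k       (suc n) rewrite +-suc d b = trans (go zero b k n) (sym (shift-y-suc (c + 0) (d + b) f k n))
  go zero    zero    k       n       rewrite +-identityʳ c | +-identityʳ d = refl

shift-monomial : ∀ a b c d → shift a b (monomial c d) ≈ monomial (c + a) (d + b)
shift-monomial a b c d = coeffwise (go a b)
  where
  go : ∀ a b k n → shift a b (monomial c d) k n ≡ monomial (c + a) (d + b) k n
  go (suc a) b       zero    n       rewrite +-suc c a = refl
  go (suc a) b       (suc k) n       rewrite +-suc c a = go a b k n
  go zero    (suc b) k       zero    rewrite +-suc d b | ∧-zeroʳ (k ≡ᵇ c + 0) = refl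
  go zero    (suc b) k       (suc n) rewrite +-suc d b = go zero b k n
  go zero    zero    k       n       rewrite +-identityʳ c | +-identityʳ d = refl

sumUpTo : ℕ → (ℕ → ℤ) → ℤ
sumUpTo m h = sumℤ (map h (upTo m))

sum-map-cong : ∀ {A : Set} {h h′ : A → ℤ} → (∀ x → h x ≡ h′ x) → ∀ xs → sumℤ (map h xs) ≡ sumℤ (map h′ xs)
sum-map-cong h≡h′ xs = cong sumℤ (map-cong h≡h′ xs)

sum-map-+ : ∀ {A : Set} (h h′ : A → ℤ) xs →
  sumℤ (map (λ x → h x +ℤ h′ x) xs) ≡ sumℤ (map h xs) +ℤ sumℤ (map h′ xs)
sum-map-+ h h′ []       = refl
sum-map-+ h h′ (x ∷ xs) = trans (cong (h x +ℤ h′ x +ℤ_) (sum-map-+ h h′ xs))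
                                (interchange (h x) (h′ x) (sumℤ (map h xs)) (sumℤ (map h′ xs)))

sum-map-neg : ∀ {A : Set} (h : A → ℤ) xs → sumℤ (map (λ x → - h x) xs) ≡ - sumℤ (map h xs)
sum-map-neg h []       = refl
sum-map-neg h (x ∷ xs) = trans (cong (- h x +ℤ_) (sum-map-neg h xs))
                               (sym (ℤ.neg-distrib-+ (h x) (sumℤ (map h xs))))

sum-map-zero : ∀ {A : Set} {h : A → ℤ} → (∀ x → h x ≡ + 0) → ∀ xs → sumℤ (map h xs) ≡ + 0
sum-map-zero h≡0 []       = refl
sum-map-zero h≡0 (x ∷ xs) rewrite h≡0 x = trans (ℤ.+-identityˡ _) (sum-map-zero h≡0 xs)

sumUpTo-suc : ∀ m h → sumUpTo (suc m) h ≡ h 0 +ℤ sumUpTo m (h ∘ suc)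
sumUpTo-suc m h = begin
  sumℤ (map h (upTo (suc m)))          ≡⟨ cong sumℤ (map-upTo h (suc m)) ⟩
  h 0 +ℤ sumℤ (applyUpTo (h ∘ suc) m)  ≡⟨ cong (λ xs → h 0 +ℤ sumℤ xs) (map-upTo (h ∘ suc) m) ⟨
  h 0 +ℤ sumUpTo m (h ∘ suc)           ∎
  where open ≡-Reasoning

sumUpTo-single : ∀ m a {h : ℕ → ℤ} → (∀ i → i ≢ a → h i ≡ + 0) → sumUpTo m h ≡ (if a <ᵇ m then h a else + 0)
sumUpTo-single zero    a       off = refl
sumUpTo-single (suc m) zero    {h} off = begin
  sumUpTo (suc m) h                 ≡⟨ sumUpTo-suc m h ⟩
  h 0 +ℤ sumUpTo m (h ∘ suc)        ≡⟨ cong (h 0 +ℤ_) (sum-map-zero (λ i → off (suc i) λ ()) (upTo m)) ⟩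
  h 0 +ℤ + 0                        ≡⟨ ℤ.+-identityʳ (h 0) ⟩
  h 0                               ∎
  where open ≡-Reasoning
sumUpTo-single (suc m) (suc a) {h} off = begin
  sumUpTo (suc m) h                 ≡⟨ sumUpTo-suc m h ⟩
  h 0 +ℤ sumUpTo m (h ∘ suc)        ≡⟨ cong (_+ℤ sumUpTo m (h ∘ suc)) (off 0 λ ()) ⟩
  + 0 +ℤ sumUpTo m (h ∘ suc)        ≡⟨ ℤ.+-identityˡ _ ⟩
  sumUpTo m (h ∘ suc)               ≡⟨ sumUpTo-single m a (λ i i≢a → off (suc i) (i≢a ∘ cong pred)) ⟩
  (if a <ᵇ m then h (suc a) else + 0) ∎
  where open ≡-Reasoning

doubleSum : ℕ → ℕ → (ℕ → ℕ → ℤ) → ℤ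
doubleSum k n F = sumUpTo (suc k) (λ i → sumUpTo (suc n) (F i))

doubleSum-cong : ∀ k n {F F′ : ℕ → ℕ → ℤ} → (∀ i j → F i j ≡ F′ i j) → doubleSum k n F ≡ doubleSum k n F′
doubleSum-cong k n F≡F′ = sum-map-cong (λ i → sum-map-cong (F≡F′ i) (upTo (suc n))) (upTo (suc k))

doubleSum-+ : ∀ k n (F F′ : ℕ → ℕ → ℤ) →
  doubleSum k n (λ i j → F i j +ℤ F′ i j) ≡ doubleSum k n F +ℤ doubleSum k n F′
doubleSum-+ k n F F′ =
  trans (sum-map-cong (λ i → sum-map-+ (F i) (F′ i) (upTo (suc n))) (upTo (suc k)))
        (sum-map-+ (λ i → sumUpTo (suc n) (F i)) (λ i → sumUpTo (suc n) (F′ i)) (upTo (suc k)))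

doubleSum-neg : ∀ k n (F : ℕ → ℕ → ℤ) → doubleSum k n (λ i j → - F i j) ≡ - doubleSum k n F
doubleSum-neg k n F =
  trans (sum-map-cong (λ i → sum-map-neg (F i) (upTo (suc n))) (upTo (suc k)))
        (sum-map-neg (λ i → sumUpTo (suc n) (F i)) (upTo (suc k)))

⊛-congˡ : ∀ {f f′} g → f ≈ f′ → f ⊛ g ≈ f′ ⊛ g
⊛-congˡ g f≈f′ = coeffwise λ k n →
  doubleSum-cong k n λ i j → cong (_*ℤ g (k ∸ i) (n ∸ j)) (coeff f≈f′ i j)

⊛-distribʳ-⊕ : ∀ f f′ g → (f ⊕ f′) ⊛ g ≈ f ⊛ g ⊕ f′ ⊛ g
⊛-distribʳ-⊕ f f′ g = coeffwise λ k n →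
  trans (doubleSum-cong k n λ i j → ℤ.*-distribʳ-+ (g (k ∸ i) (n ∸ j)) (f i j) (f′ i j))
        (doubleSum-+ k n (λ i j → f i j *ℤ g (k ∸ i) (n ∸ j)) (λ i j → f′ i j *ℤ g (k ∸ i) (n ∸ j)))

⊛-neg : ∀ f g → (⊝ f) ⊛ g ≈ ⊝ (f ⊛ g)
⊛-neg f g = coeffwise λ k n →
  trans (doubleSum-cong k n λ i j → sym (ℤ.neg-distribˡ-* (f i j) (g (k ∸ i) (n ∸ j))))
        (doubleSum-neg k n (λ i j → f i j *ℤ g (k ∸ i) (n ∸ j)))

⊛-distribʳ-⊖ : ∀ f f′ g → (f ⊖ f′) ⊛ g ≈ f ⊛ g ⊖ f′ ⊛ g
⊛-distribʳ-⊖ f f′ g = begin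
  (f ⊕ ⊝ f′) ⊛ g        ≈⟨ ⊛-distribʳ-⊕ f (⊝ f′) g ⟩
  f ⊛ g ⊕ (⊝ f′) ⊛ g    ≈⟨ ⊕-congˡ (f ⊛ g) (⊛-neg f′ g) ⟩
  f ⊛ g ⊖ f′ ⊛ g        ∎
  where open SetoidReasoning seriesSetoid

shift-closed : ∀ a b f k n →
  shift a b f k n ≡ (if a <ᵇ suc k then (if b <ᵇ suc n then f (k ∸ a) (n ∸ b) else + 0) else + 0)
shift-closed (suc a) b       f zero    n       = refl
shift-closed (suc a) b       f (suc k) n       = shift-closed a b f k n
shift-closed zero    (suc b) f k       zero    = refl
shift-closed zero    (suc b) f k       (suc n) = shift-closed zero b f k n
shift-closed zero    zero    f k       n       = refl

monomial-⊛ : ∀ a b g → monomial a b ⊛ g ≈ shift a b g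
monomial-⊛ a b g = coeffwise λ k n → begin
  doubleSum k n (λ i j → monomial a b i j *ℤ g (k ∸ i) (n ∸ j))
    ≡⟨ sumUpTo-single (suc k) a (λ i i≢a →
         sum-map-zero (λ j → cong (_*ℤ g (k ∸ i) (n ∸ j)) (monomial-offˣ {b = b} j i≢a)) (upTo (suc n))) ⟩
  (if a <ᵇ suc k then sumUpTo (suc n) (λ j → monomial a b a j *ℤ g (k ∸ a) (n ∸ j)) else + 0)
    ≡⟨ cong (λ z → if a <ᵇ suc k then z else + 0)
         (sumUpTo-single (suc n) b (λ j j≢b → cong (_*ℤ g (k ∸ a) (n ∸ j)) (monomial-offʸ a j≢b))) ⟩
  (if a <ᵇ suc k then (if b <ᵇ suc n then monomial a b a b *ℤ g (k ∸ a) (n ∸ b) else + 0) else + 0)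
    ≡⟨ cong (λ z → if a <ᵇ suc k then (if b <ᵇ suc n then z else + 0) else + 0)
         (trans (cong (_*ℤ g (k ∸ a) (n ∸ b)) (monomial-diag a b)) (ℤ.*-identityˡ (g (k ∸ a) (n ∸ b)))) ⟩
  (if a <ᵇ suc k then (if b <ᵇ suc n then g (k ∸ a) (n ∸ b) else + 0) else + 0)
    ≡⟨ shift-closed a b g k n ⟨
  shift a b g k n ∎
  where open ≡-Reasoning

Den≈ : Den ≈ 1ₛ ⊖ monomial 1 2 ⊖ monomial 2 3 ⊖ monomial 2 4 ⊕ monomial 3 6
Den≈ = coeffwise go
  where
  go : ∀ k n → Den k n ≡ (1ₛ ⊖ monomial 1 2 ⊖ monomial 2 3 ⊖ monomial 2 4 ⊕ monomial 3 6) k n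
  go 0 0 = refl
  go 0 (suc _) = refl
  go 1 0 = refl
  go 1 1 = refl
  go 1 2 = refl
  go 1 (suc (suc (suc _))) = refl
  go 2 0 = refl
  go 2 1 = refl
  go 2 2 = refl
  go 2 3 = refl
  go 2 4 = refl
  go 2 (suc (suc (suc (suc (suc _))))) = refl
  go 3 0 = refl
  go 3 1 = refl
  go 3 2 = refl
  go 3 3 = refl
  go 3 4 = refl
  go 3 5 = refl
  go 3 6 = refl
  go 3 (suc (suc (suc (suc (suc (suc (suc _))))))) = refl
  go (suc (suc (suc (suc _)))) _ = refl

Num≈ : Num ≈ 1ₛ ⊕ monomial 1 1 ⊖ monomial 1 2 ⊕ monomial 2 2 ⊕ monomial 2 3 ⊖ monomial 3 5
Num≈ = coeffwise go
  where
  go : ∀ k n → Num k n ≡ (1ₛ ⊕ monomial 1 1 ⊖ monomial 1 2 ⊕ monomial 2 2 ⊕ monomial 2 3 ⊖ monomial 3 5) k n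
  go 0 0 = refl
  go 0 (suc _) = refl
  go 1 0 = refl
  go 1 1 = refl
  go 1 2 = refl
  go 1 (suc (suc (suc _))) = refl
  go 2 0 = refl
  go 2 1 = refl
  go 2 2 = refl
  go 2 3 = refl
  go 2 (suc (suc (suc (suc _)))) = refl
  go 3 0 = refl
  go 3 1 = refl
  go 3 2 = refl
  go 3 3 = refl
  go 3 4 = refl
  go 3 5 = refl
  go 3 (suc (suc (suc (suc (suc (suc _)))))) = refl
  go (suc (suc (suc (suc _)))) _ = refl

den-⊛ : ∀ g → Den ⊛ g ≈ g ⊖ shift 1 2 g ⊖ shift 2 3 g ⊖ shift 2 4 g ⊕ shift 3 6 g
den-⊛ g = begin
  Den ⊛ g
    ≈⟨ ⊛-congˡ g Den≈ ⟩
  (1ₛ ⊖ m 1 2 ⊖ m 2 3 ⊖ m 2 4 ⊕ m 3 6) ⊛ g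
    ≈⟨ ⊛-distribʳ-⊕ (1ₛ ⊖ m 1 2 ⊖ m 2 3 ⊖ m 2 4) (m 3 6) g ⟩
  (1ₛ ⊖ m 1 2 ⊖ m 2 3 ⊖ m 2 4) ⊛ g ⊕ m 3 6 ⊛ g
    ≈⟨ ⊕-cong (⊛-distribʳ-⊖ (1ₛ ⊖ m 1 2 ⊖ m 2 3) (m 2 4) g) ≈-refl ⟩
  (1ₛ ⊖ m 1 2 ⊖ m 2 3) ⊛ g ⊖ m 2 4 ⊛ g ⊕ m 3 6 ⊛ g
    ≈⟨ ⊕-cong (⊖-cong (⊛-distribʳ-⊖ (1ₛ ⊖ m 1 2) (m 2 3) g) ≈-refl) ≈-refl ⟩
  (1ₛ ⊖ m 1 2) ⊛ g ⊖ m 2 3 ⊛ g ⊖ m 2 4 ⊛ g ⊕ m 3 6 ⊛ g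
    ≈⟨ ⊕-cong (⊖-cong (⊖-cong (⊛-distribʳ-⊖ 1ₛ (m 1 2) g) ≈-refl) ≈-refl) ≈-refl ⟩
  1ₛ ⊛ g ⊖ m 1 2 ⊛ g ⊖ m 2 3 ⊛ g ⊖ m 2 4 ⊛ g ⊕ m 3 6 ⊛ g
    ≈⟨ ⊕-cong (⊖-cong (⊖-cong (⊖-cong (monomial-⊛ 0 0 g) (monomial-⊛ 1 2 g))
                 (monomial-⊛ 2 3 g)) (monomial-⊛ 2 4 g)) (monomial-⊛ 3 6 g) ⟩
  g ⊖ shift 1 2 g ⊖ shift 2 3 g ⊖ shift 2 4 g ⊕ shift 3 6 g ∎
  where
  open SetoidReasoning seriesSetoid
  m = monomial

-- The generating function

acceptSeries : State → Series
acceptSeries s k n = + count s k n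

indicator : Bool → Series
indicator b = if b then 1ₛ else 0ₛ

indicator-suc : ∀ b k n → indicator b k (suc n) ≡ + 0
indicator-suc true  k n rewrite ∧-zeroʳ (k ≡ᵇ 0) = refl
indicator-suc false k n = refl

countPred-shift : ∀ s k n → + countPred s k n ≡ shift 1 1 (acceptSeries s) k (suc n)
countPred-shift s zero    n = refl
countPred-shift s (suc k) n = refl

acceptSeries-step : ∀ s → acceptSeries s ≈
  indicator (accepting s) ⊕ shift 0 1 (acceptSeries (step s false)) ⊕ shift 1 1 (acceptSeries (step s true))
acceptSeries-step s = coeffwise go
  where
  go : ∀ k n → acceptSeries s k n ≡
    indicator (accepting s) k n +ℤ shift 0 1 (acceptSeries (step s false)) k n +ℤ shift 1 1 (acceptSeries (step s true)) k n
  go k zero = trans (cong +_ (length-filter-[ [] ] (accepts? s k))) (empty (accepting s) k)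
    where
    empty : ∀ b k → + (if does ((b Bool.≟ true) ×-dec (0 ≟ k)) then 1 else 0) ≡
      indicator b k 0 +ℤ shift 0 1 (acceptSeries (step s false)) k 0 +ℤ shift 1 1 (acceptSeries (step s true)) k 0
    empty true  zero    = refl
    empty true  (suc k) = refl
    empty false zero    = refl
    empty false (suc k) = refl
  go k (suc n) = begin
    + count s k (suc n)                                      ≡⟨ cong +_ (count-suc s k n) ⟩
    + (count (step s false) k n + countPred (step s true) k n)
                                                             ≡⟨ ℤ.pos-+ (count (step s false) k n) _ ⟩
    + 0 +ℤ acceptSeries (step s false) k n +ℤ + countPred (step s true) k n
      ≡⟨ cong₂ (λ i o → i +ℤ acceptSeries (step s false) k n +ℤ o)
               (sym (indicator-suc (accepting s) k n)) (countPred-shift (step s true) k n) ⟩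
    indicator (accepting s) k (suc n) +ℤ shift 0 1 (acceptSeries (step s false)) k (suc n)
      +ℤ shift 1 1 (acceptSeries (step s true)) k (suc n)    ∎
    where open ≡-Reasoning

JSeries≈ : JSeries ≈ acceptSeries ready
JSeries≈ = coeffwise λ k n → cong +_ (J≡count k n)

acceptSeries-dead : acceptSeries dead ≈ 0ₛ
acceptSeries-dead = coeffwise λ k n → cong +_ (cong length (filter-none (accepts? dead k)
  (All.universal (λ c (acc , _) → true≢false (trans (sym acc) (run-dead c))) (allConfigs n))))

acceptSeries-forced : ∀ s → accepting s ≡ false → step s false ≡ dead →
  acceptSeries s ≈ shift 1 1 (acceptSeries (step s true))
acceptSeries-forced s rejecting 0→dead = begin
  acceptSeries s
    ≈⟨ acceptSeries-step s ⟩
  indicator (accepting s) ⊕ shift 0 1 (acceptSeries (step s false)) ⊕ X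
    ≡⟨ cong₂ (λ b t → indicator b ⊕ shift 0 1 (acceptSeries t) ⊕ X) rejecting 0→dead ⟩
  0ₛ ⊕ shift 0 1 (acceptSeries dead) ⊕ X
    ≈⟨ ⊕-cong (⊕-congˡ 0ₛ (≈-trans (shift-cong 0 1 acceptSeries-dead) (shift-0ₛ 0 1))) ≈-refl ⟩
  0ₛ ⊕ 0ₛ ⊕ X
    ≈⟨ coeffwise (λ k n → ℤ.+-identityˡ (X k n)) ⟩
  X ∎
  where
  open SetoidReasoning seriesSetoid
  X = shift 1 1 (acceptSeries (step s true))

series-J : JSeries ≈ 1ₛ ⊕ shift 2 3 (acceptSeries end11) ⊕ shift 1 1 (acceptSeries end01)
series-J = begin
  JSeries
    ≈⟨ ≈-trans JSeries≈ (acceptSeries-step ready) ⟩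
  1ₛ ⊕ shift 0 1 (acceptSeries open0) ⊕ shift 1 1 U
    ≈⟨ ⊕-cong (⊕-congˡ 1ₛ (shift-cong 0 1 open0-forced)) ≈-refl ⟩
  1ₛ ⊕ shift 0 1 (shift 1 1 (shift 1 1 V)) ⊕ shift 1 1 U
    ≈⟨ ⊕-cong (⊕-congˡ 1ₛ (≈-trans (shift-cong 0 1 (shift-shift 1 1 1 1 V)) (shift-shift 0 1 2 2 V))) ≈-refl ⟩
  1ₛ ⊕ shift 2 3 V ⊕ shift 1 1 U ∎
  where
  open SetoidReasoning seriesSetoid
  U = acceptSeries end01
  V = acceptSeries end11
  open0-forced : acceptSeries open0 ≈ shift 1 1 (shift 1 1 V)
  open0-forced = ≈-trans (acceptSeries-forced open0 refl refl) (shift-cong 1 1 (acceptSeries-forced open01 refl refl))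

series-end01 : acceptSeries end01 ≈ 1ₛ ⊕ shift 1 2 (acceptSeries end01) ⊕ shift 1 1 (acceptSeries end11)
series-end01 = begin
  acceptSeries end01
    ≈⟨ acceptSeries-step end01 ⟩
  1ₛ ⊕ shift 0 1 (acceptSeries end010) ⊕ shift 1 1 (acceptSeries end11)
    ≈⟨ ⊕-cong (⊕-congˡ 1ₛ (shift-cong 0 1 (acceptSeries-forced end010 refl refl))) ≈-refl ⟩
  1ₛ ⊕ shift 0 1 (shift 1 1 (acceptSeries end01)) ⊕ shift 1 1 (acceptSeries end11)
    ≈⟨ ⊕-cong (⊕-congˡ 1ₛ (shift-shift 0 1 1 1 _)) ≈-refl ⟩
  1ₛ ⊕ shift 1 2 (acceptSeries end01) ⊕ shift 1 1 (acceptSeries end11) ∎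
  where open SetoidReasoning seriesSetoid

series-end11 : acceptSeries end11 ≈ 1ₛ ⊕ shift 0 1 JSeries
series-end11 = begin
  acceptSeries end11
    ≈⟨ acceptSeries-step end11 ⟩
  1ₛ ⊕ shift 0 1 (acceptSeries ready) ⊕ shift 1 1 (acceptSeries dead)
    ≈⟨ ⊕-cong (⊕-congˡ 1ₛ (shift-cong 0 1 (≈-sym JSeries≈)))
              (≈-trans (shift-cong 1 1 acceptSeries-dead) (shift-0ₛ 1 1)) ⟩
  1ₛ ⊕ shift 0 1 JSeries ⊕ 0ₛ
    ≈⟨ coeffwise (λ k n → ℤ.+-identityʳ _) ⟩
  1ₛ ⊕ shift 0 1 JSeries ∎
  where open SetoidReasoning seriesSetoid

shift-equation₁ : ∀ {f g} c d → f ≈ 1ₛ ⊕ shift c d g →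
  ∀ a b → shift a b f ≈ monomial a b ⊕ shift (c + a) (d + b) g
shift-equation₁ {f} {g} c d f≈ a b = begin
  shift a b f                             ≈⟨ ≈-trans (shift-cong a b f≈) (shift-⊕ a b _ _) ⟩
  shift a b 1ₛ ⊕ shift a b (shift c d g)  ≈⟨ ⊕-cong (shift-monomial a b 0 0) (shift-shift a b c d g) ⟩
  monomial a b ⊕ shift (c + a) (d + b) g  ∎
  where open SetoidReasoning seriesSetoid

shift-equation₂ : ∀ {f g h} c d e p → f ≈ 1ₛ ⊕ shift c d g ⊕ shift e p h →
  ∀ a b → shift a b f ≈ monomial a b ⊕ shift (c + a) (d + b) g ⊕ shift (e + a) (p + b) h
shift-equation₂ {f} {g} {h} c d e p f≈ a b = begin
  shift a b f
    ≈⟨ ≈-trans (shift-cong a b f≈) (shift-⊕ a b _ _) ⟩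
  shift a b (1ₛ ⊕ shift c d g) ⊕ shift a b (shift e p h)
    ≈⟨ ⊕-cong (shift-equation₁ c d ≈-refl a b) (shift-shift a b e p h) ⟩
  monomial a b ⊕ shift (c + a) (d + b) g ⊕ shift (e + a) (p + b) h ∎
  where open SetoidReasoning seriesSetoid

-- With j, u, v the coefficients of x^a y^b J, x^a y^b U, x^a y^b V at a fixed (k, n), this is
-- Den · J - Num = (1 - x y²) E_J + x y E_U + (x² y² + x² y³ - x³ y⁵) E_V, where E_J, E_U, E_V are
-- the three equations, read off at the coefficient of x^k y^n.
elimination : ∀ (j u v m : ℕ → ℕ → ℤ) →
  (∀ a b → j a b ≡ m a b +ℤ v (2 + a) (3 + b) +ℤ u (1 + a) (1 + b)) →
  (∀ a b → u a b ≡ m a b +ℤ u (1 + a) (2 + b) +ℤ v (1 + a) (1 + b)) →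
  (∀ a b → v a b ≡ m a b +ℤ j a (1 + b)) →
  j 0 0 - j 1 2 - j 2 3 - j 2 4 +ℤ j 3 6 ≡ m 0 0 +ℤ m 1 1 - m 1 2 +ℤ m 2 2 +ℤ m 2 3 - m 3 5
elimination j u v m j-eq u-eq v-eq
  rewrite j-eq 0 0 | j-eq 1 2 | u-eq 1 1 | v-eq 2 2 | v-eq 2 3 | v-eq 3 5
  = identity (j 2 3) (j 2 4) (j 3 6) (u 2 3) (m 0 0) (m 1 1) (m 1 2) (m 2 2) (m 2 3) (m 3 5)
  where
  identity : ∀ j23 j24 j36 u23 m00 m11 m12 m22 m23 m35 →
    m00 +ℤ (m23 +ℤ j24) +ℤ (m11 +ℤ u23 +ℤ (m22 +ℤ j23)) - (m12 +ℤ (m35 +ℤ j36) +ℤ u23) - j23 - j24 +ℤ j36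
    ≡ m00 +ℤ m11 - m12 +ℤ m22 +ℤ m23 - m35
  identity = solve-∀

mainTheorem2 : ∀ (k n : ℕ) → (Den ⊛ JSeries) k n ≡ Num k n
mainTheorem2 k n = begin
  (Den ⊛ JSeries) k n                                ≡⟨ coeff (den-⊛ JSeries) k n ⟩
  j 0 0 - j 1 2 - j 2 3 - j 2 4 +ℤ j 3 6             ≡⟨ elimination j u v m
                                                          (λ a b → coeff (shift-equation₂ 2 3 1 1 series-J a b) k n)
                                                          (λ a b → coeff (shift-equation₂ 1 2 1 1 series-end01 a b) k n)
                                                          (λ a b → coeff (shift-equation₁ 0 1 series-end11 a b) k n) ⟩
  m 0 0 +ℤ m 1 1 - m 1 2 +ℤ m 2 2 +ℤ m 2 3 - m 3 5  ≡⟨ coeff Num≈ k n ⟨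
  Num k n                                            ∎
  where
  open ≡-Reasoning
  j u v m : ℕ → ℕ → ℤ
  j a b = shift a b JSeries k n
  u a b = shift a b (acceptSeries end01) k n
  v a b = shift a b (acceptSeries end11) k n
  m a b = monomial a b k n
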